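{- Let $G$ be a finite group, $S\subseteq G$ with $1_G\notin S$, $S=S^{ -1}$, let $N\triangleleft G$, let ${\mathcal B}$ be the set of orbits of $N_L=\{x\mapsto nx:n\in N\}$ (i.e. the cosets of $N$), and let ${\mathcal A}^o$ be the group of color-preserving automorphisms of ${\rm Cay}(G,S)$. If ${\mathcal B}$ is an ${\mathcal A}^o$-invariant partition and $\alpha\in{\mathcal A}^o$, then the permutation $\alpha/{\mathcal B}$ induced by $\alpha$ on ${\mathcal B}=G/N$ is a color-preserving automorphism of ${\rm Cay}(G/N,S/N)$, where $S/N=\{sN:s\in S\}$.
   Context: ${\rm Cay}(G,S)$ has vertex set $G$ and edges $\{g,gs\}$; the edge $\{g,gs\}$ is colored $c(s)$ where $c(s)=c(s')$ iff $s'\in\{s,s^{ -1}\}$. An automorphism $\alpha$ is color-preserving if for every edge $(g,gs)$, $\alpha(g,gs)=(h,hs)$ or $(h,hs^{ -1})$ for some $h$. An invariant partition of a permutation group is a partition whose parts are permuted by the group; for $\alpha$ preserving ${\mathcal B}$, $\alpha/{\mathcal B}$ denotes the induced permutation of the blocks. -}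

module Defs where

open import Level using (Level; _⊔_)
open import Algebra.Bundles using (Group)
open import Data.Nat using (ℕ)
open import Data.Fin using (Fin)
open import Data.Product using (Σ; ∃; ∃-syntax; _×_)
open import Data.Sum using (_⊎_)
open import Relation.Nullary using (¬_)

module CayleyDefs {c ℓ : Level} (G : Group c ℓ) where
  open Group G

  IsFinite : Set (c ⊔ ℓ)
  IsFinite = ∃[ n ] Σ (Fin n → Carrier) λ f → ∀ g → ∃[ i ] f i ≈ g

  record IsConnectionSet (S : Carrier → Set ℓ) : Set (c ⊔ ℓ) where
    field
      resp   : ∀ {x y} → x ≈ y → S x → S y
      noUnit : ¬ S ε
      symm   : ∀ {s} → S s → S (s ⁻¹)

  record IsNormalSubgroup (N : Carrier → Set ℓ) : Set (c ⊔ ℓ) where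
    field
      resp   : ∀ {x y} → x ≈ y → N x → N y
      unit   : N ε
      mul    : ∀ {x y} → N x → N y → N (x ∙ y)
      inv    : ∀ {x} → N x → N (x ⁻¹)
      conj   : ∀ g {n} → N n → N ((g ∙ n) ∙ g ⁻¹)

  Adj : (Carrier → Set ℓ) → Carrier → Carrier → Set ℓ
  Adj S x y = S (x ⁻¹ ∙ y)

  IsPerm : (Carrier → Carrier) → Set (c ⊔ ℓ)
  IsPerm α = (∀ {x y} → x ≈ y → α x ≈ α y)
           × (∀ {x y} → α x ≈ α y → x ≈ y)
           × (∀ y → ∃[ x ] α x ≈ y)

  IsAut : (Carrier → Set ℓ) → (Carrier → Carrier) → Set (c ⊔ ℓ)
  IsAut S α = IsPerm α
            × (∀ x y → (Adj S x y → Adj S (α x) (α y)) × (Adj S (α x) (α y) → Adj S x y))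

  IsColorPreserving : (Carrier → Set ℓ) → (Carrier → Carrier) → Set (c ⊔ ℓ)
  IsColorPreserving S α = ∀ g s → S s → (α (g ∙ s) ≈ α g ∙ s) ⊎ (α (g ∙ s) ≈ α g ∙ s ⁻¹)

  IsColorAut : (Carrier → Set ℓ) → (Carrier → Carrier) → Set (c ⊔ ℓ)
  IsColorAut S α = IsAut S α × IsColorPreserving S α

  SameBlock : (Carrier → Set ℓ) → Carrier → Carrier → Set (c ⊔ ℓ)
  SameBlock N x y = ∃[ n ] N n × y ≈ n ∙ x

  IsInvariantPartition : (Carrier → Set ℓ) → (Carrier → Set ℓ) → Set (c ⊔ ℓ)
  IsInvariantPartition S N =
    ∀ α → IsColorAut S α → ∀ x → ∃[ y ] ∀ z →
      ((∃[ w ] SameBlock N x w × α w ≈ z) → SameBlock N y z)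
      × (SameBlock N y z → ∃[ w ] SameBlock N x w × α w ≈ z)

  -- Cay(G/N, S/N): vertices are blocks (represented by elements of G, modulo
  -- SameBlock N); [x] and [y] adjacent iff [y] = [x][s] = [xs] for some s ∈ S.
  QAdj : (Carrier → Set ℓ) → (Carrier → Set ℓ) → Carrier → Carrier → Set (c ⊔ ℓ)
  QAdj N S x y = ∃[ s ] S s × SameBlock N (x ∙ s) y

  -- α/𝓑 (given on representatives by x ↦ α x) is a well-defined permutation of G/N
  IsQuotPerm : (Carrier → Set ℓ) → (Carrier → Carrier) → Set (c ⊔ ℓ)
  IsQuotPerm N α = (∀ {x y} → SameBlock N x y → SameBlock N (α x) (α y))
                 × (∀ {x y} → SameBlock N (α x) (α y) → SameBlock N x y)
                 × (∀ y → ∃[ x ] SameBlock N (α x) y)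

  IsQuotAut : (Carrier → Set ℓ) → (Carrier → Set ℓ) → (Carrier → Carrier) → Set (c ⊔ ℓ)
  IsQuotAut N S α = IsQuotPerm N α
    × (∀ x y → (QAdj N S x y → QAdj N S (α x) (α y)) × (QAdj N S (α x) (α y) → QAdj N S x y))

  IsQuotColorPreserving : (Carrier → Set ℓ) → (Carrier → Set ℓ) → (Carrier → Carrier) → Set (c ⊔ ℓ)
  IsQuotColorPreserving N S α = ∀ x s → S s →
    SameBlock N (α x ∙ s) (α (x ∙ s)) ⊎ SameBlock N (α x ∙ s ⁻¹) (α (x ∙ s))

  IsQuotColorAut : (Carrier → Set ℓ) → (Carrier → Set ℓ) → (Carrier → Carrier) → Set (c ⊔ ℓ)
  IsQuotColorAut N S α = IsQuotAut N S α × IsQuotColorPreserving N S α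

module Submission where

-- Only three facts about
-- α ∈ 𝒜ᵒ are needed, and each quotient property follows from some of them:
--   * α maps every block onto a block (invariance of 𝓑) and α is a
--     bijection of G, so x ↦ α x is a well-defined, injective and surjective
--     map on blocks, i.e. a permutation α/𝓑 of G/N;
--   * α is colour-preserving, α(xs) ∈ {α(x)s, α(x)s⁻¹}, which is literally
--     colour preservation of α/𝓑 and, as S = S⁻¹, gives that α/𝓑 maps edges
--     of Cay(G/N,S/N) to edges;
--   * α reflects adjacency of Cay(G,S); lifting an edge [α x] — [α x][s] to
--     the vertex g with α g = α(x)s shows that α/𝓑 also reflects edges.

open import Defs
open import Level using (Level; _⊔_)
open import Algebra.Bundles using (Group)
open import Data.Product using (∃-syntax; _×_; _,_; proj₁; proj₂)
open import Data.Sum using (inj₁; inj₂)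
import Algebra.Properties.Group as GroupProperties
import Relation.Binary.Reasoning.Setoid as SetoidReasoning
open CayleyDefs

-- The development is relative to a subgroup N of G: closure under ε, ∙ and ⁻¹
-- is all that the block structure needs.
module Blocks {c ℓ : Level} (G : Group c ℓ) (N : Group.Carrier G → Set ℓ)
  (unit : N (Group.ε G))
  (mul  : ∀ {x y} → N x → N y → N (Group._∙_ G x y))
  (inv  : ∀ {x} → N x → N (Group._⁻¹ G x)) where

  open Group G
  open GroupProperties G using (\\-leftDividesˡ; \\-leftDividesʳ)
  open SetoidReasoning setoid

  sameBlock-≈ : ∀ {x y} → x ≈ y → SameBlock G N x y
  sameBlock-≈ {x} {y} x≈y = ε , unit , (begin
    y      ≈⟨ sym x≈y ⟩
    x      ≈⟨ identityˡ x ⟨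
    ε ∙ x  ∎)

  sameBlock-refl : ∀ {x} → SameBlock G N x x
  sameBlock-refl = sameBlock-≈ refl

  sameBlock-sym : ∀ {x y} → SameBlock G N x y → SameBlock G N y x
  sameBlock-sym {x} {y} (n , n∈N , y≈nx) = n ⁻¹ , inv n∈N , (begin
    x               ≈⟨ \\-leftDividesʳ n x ⟨
    n ⁻¹ ∙ (n ∙ x)  ≈⟨ ∙-congˡ y≈nx ⟨
    n ⁻¹ ∙ y        ∎)

  sameBlock-trans : ∀ {x y z} → SameBlock G N x y → SameBlock G N y z → SameBlock G N x z
  sameBlock-trans {x} {y} {z} (n , n∈N , y≈nx) (m , m∈N , z≈my) = m ∙ n , mul m∈N n∈N , (begin
    z            ≈⟨ z≈my ⟩
    m ∙ y        ≈⟨ ∙-congˡ y≈nx ⟩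
    m ∙ (n ∙ x)  ≈⟨ assoc m n x ⟨
    m ∙ n ∙ x    ∎)

  MapsBlocksOntoBlocks : (Carrier → Carrier) → Set (c ⊔ ℓ)
  MapsBlocksOntoBlocks α = ∀ x → ∃[ y ] ∀ z →
      ((∃[ w ] SameBlock G N x w × α w ≈ z) → SameBlock G N y z)
      × (SameBlock G N y z → ∃[ w ] SameBlock G N x w × α w ≈ z)

  module _ {α : Carrier → Carrier} (onto : MapsBlocksOntoBlocks α) where

    -- α/𝓑 is well defined: α x and α y land in the image block of [x].
    blocks-preserved : ∀ {x y} → SameBlock G N x y → SameBlock G N (α x) (α y)
    blocks-preserved {x} {y} x~y with onto x
    ... | b , image = sameBlock-trans (sameBlock-sym αx∈b) αy∈b
      where
      αx∈b : SameBlock G N b (α x)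
      αx∈b = proj₁ (image (α x)) (x , sameBlock-refl , refl)
      αy∈b : SameBlock G N b (α y)
      αy∈b = proj₁ (image (α y)) (y , x~y , refl)

    -- α/𝓑 is injective: if α y lies in the image block of [x], then
    -- α y = α w for some w ~ x, and injectivity of α gives y ≈ w.
    blocks-reflected : (∀ {x y} → α x ≈ α y → x ≈ y) →
                       ∀ {x y} → SameBlock G N (α x) (α y) → SameBlock G N x y
    blocks-reflected injective {x} {y} αx~αy with onto x
    ... | b , image = pullBack (proj₂ (image (α y)) (sameBlock-trans αx∈b αx~αy))
      where
      αx∈b : SameBlock G N b (α x)
      αx∈b = proj₁ (image (α x)) (x , sameBlock-refl , refl)
      pullBack : ∃[ w ] SameBlock G N x w × α w ≈ α y → SameBlock G N x y
      pullBack (w , x~w , αw≈αy) = sameBlock-trans x~w (sameBlock-≈ (injective αw≈αy))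

  inducedPerm : ∀ {α} → IsPerm G α → MapsBlocksOntoBlocks α → IsQuotPerm G N α
  inducedPerm (_ , injective , surjective) onto =
      blocks-preserved onto
    , blocks-reflected onto injective
    , λ y → let (x , αx≈y) = surjective y in x , sameBlock-≈ αx≈y

  module _ {α : Carrier → Carrier} (S : Carrier → Set ℓ) (colour : IsColorPreserving G S α) where

    quotColorPreserving : IsQuotColorPreserving G N S α
    quotColorPreserving x s s∈S with colour x s s∈S
    ... | inj₁ αxs≈αx∙s  = inj₁ (sameBlock-≈ (sym αxs≈αx∙s))
    ... | inj₂ αxs≈αx∙s⁻¹ = inj₂ (sameBlock-≈ (sym αxs≈αx∙s⁻¹))

    -- Edges [x] — [xs] go to edges [α x] — [α x][s^{±1}]; S = S⁻¹ keeps the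
    -- label in S/N.
    quotAdj-preserved : (∀ {s} → S s → S (s ⁻¹)) → MapsBlocksOntoBlocks α →
                        ∀ x y → QAdj G N S x y → QAdj G N S (α x) (α y)
    quotAdj-preserved symm onto x y (s , s∈S , xs~y) with colour x s s∈S
    ... | inj₁ αxs≈αx∙s =
      s , s∈S , sameBlock-trans (sameBlock-≈ (sym αxs≈αx∙s)) (blocks-preserved onto xs~y)
    ... | inj₂ αxs≈αx∙s⁻¹ =
      s ⁻¹ , symm s∈S , sameBlock-trans (sameBlock-≈ (sym αxs≈αx∙s⁻¹)) (blocks-preserved onto xs~y)

  -- An edge [α x] — [α x][s] lifts to the edge x — g of Cay(G,S), where α g = α(x)s;
  -- since α reflects adjacency, [x] — [y] is an edge of Cay(G/N,S/N).
  quotAdj-reflected : (α : Carrier → Carrier) (S : Carrier → Set ℓ) →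
                      (∀ {x y} → x ≈ y → S x → S y) →
                      (∀ x y → Adj G S (α x) (α y) → Adj G S x y) →
                      (∀ y → ∃[ x ] α x ≈ y) →
                      (∀ {x y} → SameBlock G N (α x) (α y) → SameBlock G N x y) →
                      ∀ x y → QAdj G N S (α x) (α y) → QAdj G N S x y
  quotAdj-reflected α S resp adj-reflected surjective reflected x y (s , s∈S , αx∙s~αy)
    with surjective (α x ∙ s)
  ... | g , αg≈αx∙s = x ⁻¹ ∙ g , x⁻¹g∈S , sameBlock-trans (sameBlock-≈ (\\-leftDividesˡ x g)) g~y
    where
    x⁻¹g∈S : S (x ⁻¹ ∙ g)
    x⁻¹g∈S = adj-reflected x g (resp (begin
      s                     ≈⟨ \\-leftDividesʳ (α x) s ⟨
      α x ⁻¹ ∙ (α x ∙ s)    ≈⟨ ∙-congˡ αg≈αx∙s ⟨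
      α x ⁻¹ ∙ α g          ∎) s∈S)
    g~y : SameBlock G N g y
    g~y = reflected (sameBlock-trans (sameBlock-≈ αg≈αx∙s) αx∙s~αy)

lemma3p4 : {c ℓ : Level} (G : Group c ℓ) → IsFinite G →
    (S N : Group.Carrier G → Set ℓ) → IsConnectionSet G S → IsNormalSubgroup G N →
    IsInvariantPartition G S N →
    (α : Group.Carrier G → Group.Carrier G) → IsColorAut G S α →
    IsQuotColorAut G N S α
lemma3p4 G _ S N isConn isNormal invariant α αIsColorAut@((αIsPerm , adjacency) , colour) =
  (quotPerm , quotAdj) , quotColorPreserving S colour
  where
  module CS = IsConnectionSet isConn
  module NS = IsNormalSubgroup isNormal
  open Blocks G N NS.unit NS.mul NS.inv

  onto : MapsBlocksOntoBlocks α
  onto = invariant α αIsColorAut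

  quotPerm : IsQuotPerm G N α
  quotPerm = inducedPerm αIsPerm onto

  quotAdj : ∀ x y → (QAdj G N S x y → QAdj G N S (α x) (α y))
                  × (QAdj G N S (α x) (α y) → QAdj G N S x y)
  quotAdj x y =
      quotAdj-preserved S colour CS.symm onto x y
    , quotAdj-reflected α S CS.resp (λ u v → proj₂ (adjacency u v))
                        (proj₂ (proj₂ αIsPerm)) (proj₁ (proj₂ quotPerm)) x y
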